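{- Let $NC$ be an initial neuronal circuit satisfying $\mathit{ParallelComposition}(NC)$, let $n=|ln_{NC}|$, let $N_0$ be the neuron of $ln_{NC}$ with identifier $0$, assume $w_{N_0}(n)\ge\tau_{N_0}$, and let $\mathit{inp}$ be an external input sequence (a list of booleans). (1) $output_{NC}(N_0,\mathit{inp})=\mathit{inp}\mathbin{++}[0]$. (2) If $N\in ln_{NC}$ with $id_N\neq 0$ and $w_N(0)\ge\tau_N$, then $output_{NC}(N,\mathit{inp})=\mathit{inp}[1:\,]\mathbin{++}[0;0]$ if $0<|\mathit{inp}|$, and $output_{NC}(N,\mathit{inp})=[0]$ otherwise.
   Context: Booleans are identified with $0$ (false) and $1$ (true). A neuron $N$ consists of an identifier $id_N\in\mathbb{N}$, a weight function $w_N:\mathbb{N}\to\mathbb{Q}$ with $-1\le w_N(x)\le 1$ for all $x$ and $w_N(id_N)=0$, a leak factor $lk_N\in\mathbb{Q}$ with $0\le lk_N\le 1$, a threshold $\tau_N\in\mathbb{Q}$ with $\tau_N>0$, an output list $Output(N)$ of booleans (most recent first) and a current potential $CurPot(N)\in\mathbb{Q}$, subject to: $(\tau_N\le CurPot(N))$ equals the head of $Output(N)$ (the head of an empty list being $0$). An input function is a map $i:\mathbb{N}\to\{0,1\}$; $potential(w,i,len)=\sum_{0\le k<len,\ i(k)=1} w(k)$. The one-step update of $N$ with input function $i$ in an environment of $len$ neurons keeps $id,w,lk,\tau$, sets the new potential $p=potential(w_N,i,len)$ if $\tau_N\le CurPot(N)$ and $p=potential(w_N,i,len)+lk_N\cdot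 CurPot(N)$ otherwise, and sets the new output list to $(\tau_N\le p)::Output(N)$. A neuron is initial if its output list is $[0]$ and its current potential is $0$. A neuronal circuit $NC$ consists of a time $t_{NC}\in\mathbb{N}$, a list $ln_{NC}$ of neurons with pairwise distinct identifiers all $<|ln_{NC}|$ and all output lists of length $t_{NC}+1$, and a number $si_{NC}$ of external sources, with identifiers $|ln_{NC}|,\dots,L-1$ where $L=|ln_{NC}|+si_{NC}$. One step of $NC$ on an external input function $e$ replaces each neuron $N$ by its one-step update in an environment of $L$ neurons with input function $x\mapsto$ (head of the output list, before the step, of the circuit neuron with identifier $x$ if $x<|ln_{NC}|$; $e(x)$ otherwise), and increments the time. A list of external inputs (most recent first) is processed from its last element to its first. For $N\in ln_{NC}$, $output_{NC}(N,\mathit{inp})$ is the output list of the neuron with identifier $id_N$ after processing $\mathit{inp}$. $NC$ is initial if all its neurons are initial. When $si_{NC}=1$, an external input sequence is a list of booleans, each giving the value supplied by the unique external source (identifier $|ln_{NC}|$) at that step. $\mathit{ParallelComposition}(NC)$ means: $si_{NC}=1$; $|ln_{NC}|\ge1$; the neuron with identifier $0$ has $w(id')=0$ for all $id'<|ln_{NC}|$ and $w(|ln_{NC}|)>0$; for every $m$, the neuron with identifier $m+1$ (if present) has $w(id')=0$ for all $id'\ne 0$ with $id'<|ln_{NC}|+1$, and $w(0)>0$. List notation: $\mathbin{++}$ is concatenation; $[a;b]$ is the list with head $a$; $l[i:\,]$ is $l$ with its first $i$ elements removed. -}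

module Defs where

open import Data.Bool using (Bool; true; false; if_then_else_)
open import Data.Nat as ℕ using (ℕ; zero; suc)
open import Data.Rational using (ℚ; 0ℚ; 1ℚ; -_; _+_; _*_; _≤_; _<_; _≤?_)
open import Data.List using (List; []; _∷_; map; length)
open import Data.List.Relation.Unary.All using (All)
open import Data.List.Relation.Unary.Unique.Propositional using (Unique)
open import Data.List.Membership.Propositional using (_∈_)
open import Data.Maybe using (Maybe; just; nothing)
open import Data.Product using (_×_)
open import Relation.Nullary using (does)
open import Relation.Binary.PropositionalEquality using (_≡_; _≢_; refl)
open import Data.Nat using () renaming (_≟_ to _≟ℕ_; _<ᵇ_ to _<ᵇℕ_)

headB : List Bool → Bool
headB []      = false
headB (b ∷ _) = b

leB : ℚ → ℚ → Bool
leB a b = does (a ≤? b)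

record Neuron : Set where
  field
    id         : ℕ
    w          : ℕ → ℚ
    w-lower    : ∀ x → - 1ℚ ≤ w x
    w-upper    : ∀ x → w x ≤ 1ℚ
    w-self     : w id ≡ 0ℚ
    lk         : ℚ
    lk-lower   : 0ℚ ≤ lk
    lk-upper   : lk ≤ 1ℚ
    τ          : ℚ
    τ-pos      : 0ℚ < τ
    output     : List Bool
    curPot     : ℚ
    consistent : leB τ curPot ≡ headB output

open Neuron public

potential : (ℕ → ℚ) → (ℕ → Bool) → ℕ → ℚ
potential w i zero    = 0ℚ
potential w i (suc k) = potential w i k + (if i k then w k else 0ℚ)

newPot : Neuron → (ℕ → Bool) → ℕ → ℚ
newPot N i len =
  if leB (τ N) (curPot N)
  then potential (w N) i len
  else potential (w N) i len + lk N * curPot N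

update : Neuron → (ℕ → Bool) → ℕ → Neuron
update N i len = record
  { id = id N ; w = w N ; w-lower = w-lower N ; w-upper = w-upper N
  ; w-self = w-self N ; lk = lk N ; lk-lower = lk-lower N ; lk-upper = lk-upper N
  ; τ = τ N ; τ-pos = τ-pos N
  ; output = leB (τ N) (newPot N i len) ∷ output N
  ; curPot = newPot N i len
  ; consistent = refl }

IsInitial : Neuron → Set
IsInitial N = (output N ≡ false ∷ []) × (curPot N ≡ 0ℚ)

record NeuronalCircuit : Set where
  field
    time        : ℕ
    ln          : List Neuron
    si          : ℕ
    ids-unique  : Unique (map id ln)
    ids-bounded : All (λ N → id N ℕ.< length ln) ln
    out-lengths : All (λ N → length (output N) ≡ suc time) ln

open NeuronalCircuit public

findById : List Neuron → ℕ → Maybe Neuron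
findById []       x = nothing
findById (N ∷ ns) x = if does (id N ≟ℕ x) then just N else findById ns x

headOf : List Neuron → ℕ → Bool
headOf ns x with findById ns x
... | just N  = headB (output N)
... | nothing = false

stepInput : List Neuron → (ℕ → Bool) → ℕ → Bool
stepInput ns e x = if x <ᵇℕ length ns then headOf ns x else e x

stepNeurons : ℕ → List Neuron → (ℕ → Bool) → List Neuron
stepNeurons si ns e = map (λ N → update N (stepInput ns e) (length ns ℕ.+ si)) ns

-- processing a list of external inputs (most recent first) for a circuit with
-- a single external source: each boolean is the value of that source at a step;
-- the list is processed from its last element to its first.
processNeurons : ℕ → List Neuron → List Bool → List Neuron
processNeurons si ns []       = ns
processNeurons si ns (b ∷ bs) = stepNeurons si (processNeurons si ns bs) (λ _ → b)

outputNC : NeuronalCircuit → Neuron → List Bool → Maybe (List Bool)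
outputNC NC N inp with findById (processNeurons (si NC) (ln NC) inp) (id N)
... | just M  = just (output M)
... | nothing = nothing

InitialNC : NeuronalCircuit → Set
InitialNC NC = All IsInitial (ln NC)

ParallelComposition : NeuronalCircuit → Set
ParallelComposition NC =
  (si NC ≡ 1) ×
  (1 ℕ.≤ length (ln NC)) ×
  (∀ N → N ∈ ln NC → id N ≡ 0 →
     (∀ id' → id' ℕ.< length (ln NC) → w N id' ≡ 0ℚ) × (0ℚ < w N (length (ln NC)))) ×
  (∀ m N → N ∈ ln NC → id N ≡ suc m →
     (∀ id' → id' ≢ 0 → id' ℕ.< suc (length (ln NC)) → w N id' ≡ 0ℚ) × (0ℚ < w N 0))

{-# OPTIONS --safe #-}
module Submission where

-- Each neuron is a relay: it listens to a single source j whose weight reaches its threshold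
-- (the external source for neuron 0, neuron 0 for the others). By induction on time, a relay
-- that did not fire holds potential 0, so the leak term vanishes and the new potential is w(j)
-- or 0 according to the current value of j: the relay copies j with a delay of one step.
-- Neuron 0 therefore outputs the input, and the other neurons output the input one step late.

open import Defs
open import Data.Bool using (Bool; true; false; if_then_else_)
open import Data.Bool.Properties using (T-≡)
open import Data.Nat using (ℕ; zero; suc; pred; _+_; _<ᵇ_; _<_; _≟_; z<s; ≢-nonZero)
open import Data.Nat.Properties
  using (<⇒<ᵇ; <⇒≢; ≤∧≢⇒<; m<1+n⇒m≤n; m<n⇒m<1+n; n<1+n; +-comm; suc-pred)
open import Data.Rational using (ℚ; 0ℚ; _≤_; _≤?_) renaming (_+_ to _+ℚ_; _<_ to _<ℚ_)
open import Data.Rational.Properties using (+-identityˡ; +-identityʳ; *-zeroʳ; <-irrefl; <-≤-trans)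
open import Data.List using (List; []; _∷_; _++_; length; drop; map)
open import Data.List.Properties using (length-map)
open import Data.List.Membership.Propositional using (_∈_)
open import Data.List.Membership.Propositional.Properties using (∈-map⁺)
open import Data.List.Relation.Unary.Any using (here; there)
import Data.List.Relation.Unary.All as All
open import Data.List.Relation.Unary.AllPairs using (_∷_)
open import Data.List.Relation.Unary.Unique.Propositional using (Unique)
open import Data.Maybe using (just)
import Data.Maybe as Maybe
open import Data.Product using (_×_; _,_; proj₁; proj₂)
open import Function using (_∘_; Equivalence)
open import Relation.Nullary using (does; yes; no)
open import Relation.Nullary.Decidable using (dec-true; dec-false)
open import Relation.Binary.PropositionalEquality
  using (_≡_; _≢_; refl; sym; trans; cong; cong₂; subst; module ≡-Reasoning)

leB-true : ∀ {a b} → a ≤ b → leB a b ≡ true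
leB-true {a} {b} = dec-true (a ≤? b)

leB-zero : ∀ {a} → 0ℚ <ℚ a → leB a 0ℚ ≡ false
leB-zero {a} 0<a = dec-false (a ≤? 0ℚ) (λ a≤0 → <-irrefl refl (<-≤-trans 0<a a≤0))

<ᵇ-irrefl : ∀ n → (n <ᵇ n) ≡ false
<ᵇ-irrefl zero    = refl
<ᵇ-irrefl (suc n) = <ᵇ-irrefl n

if-zero : ∀ b {x} → x ≡ 0ℚ → (if b then x else 0ℚ) ≡ 0ℚ
if-zero true  x≡0 = x≡0
if-zero false _   = refl

potential-zero : ∀ (w : ℕ → ℚ) i len → (∀ k → k < len → w k ≡ 0ℚ) → potential w i len ≡ 0ℚ
potential-zero w i zero    _      = refl
potential-zero w i (suc l) silent =
  trans (cong₂ _+ℚ_ (potential-zero w i l (λ k → silent k ∘ m<n⇒m<1+n))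
                    (if-zero (i l) (silent l (n<1+n l))))
        (+-identityˡ 0ℚ)

potential-single : ∀ (w : ℕ → ℚ) i {j} len → j < len → (∀ k → k ≢ j → k < len → w k ≡ 0ℚ) →
  potential w i len ≡ (if i j then w j else 0ℚ)
potential-single w i {j} (suc l) j<1+l others with j ≟ l
... | yes refl =
  trans (cong (_+ℚ (if i j then w j else 0ℚ))
              (potential-zero w i l (λ k k<j → others k (<⇒≢ k<j) (m<n⇒m<1+n k<j))))
        (+-identityˡ _)
... | no j≢l =
  trans (cong₂ _+ℚ_ (potential-single w i l (≤∧≢⇒< (m<1+n⇒m≤n j<1+l) j≢l)
                                         (λ k k≢j → others k k≢j ∘ m<n⇒m<1+n))
                    (if-zero (i l) (others l (j≢l ∘ sym) (n<1+n l))))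
        (+-identityʳ _)

record Relay (j L : ℕ) (M : Neuron) : Set where
  field
    source<env    : j < L
    others-silent : ∀ k → k ≢ j → k < L → w M k ≡ 0ℚ
    strong        : τ M ≤ w M j

open Relay

relay-update : ∀ {j L M} i L′ → Relay j L M → Relay j L (update M i L′)
relay-update i L′ r = record
  { source<env = source<env r ; others-silent = others-silent r ; strong = strong r }

Resting : Neuron → Set
Resting M = headB (output M) ≡ false → curPot M ≡ 0ℚ

newPot-resting : ∀ M i L → Resting M → newPot M i L ≡ potential (w M) i L
newPot-resting M i L resting with leB (τ M) (curPot M) in fired
... | true  = refl
... | false rewrite resting (trans (sym (consistent M)) fired) | *-zeroʳ (lk M) = +-identityʳ _

relay-newPot : ∀ {j L} M i → Relay j L M → Resting M → newPot M i L ≡ (if i j then w M j else 0ℚ)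
relay-newPot {L = L} M i r resting =
  trans (newPot-resting M i L resting) (potential-single (w M) i L (source<env r) (others-silent r))

relay-step : ∀ {j L} M i → Relay j L M → Resting M →
  (output (update M i L) ≡ i j ∷ output M) × Resting (update M i L)
relay-step {j} M i r resting rewrite relay-newPot M i r resting with i j
... | true  rewrite leB-true (strong r) = refl , λ ()
... | false rewrite leB-zero (τ-pos M)  = refl , λ _ → refl

findById-map-update : ∀ i L ns x →
  findById (map (λ N → update N i L) ns) x ≡ Maybe.map (λ N → update N i L) (findById ns x)
findById-map-update i L []       x = refl
findById-map-update i L (N ∷ ns) x with does (id N ≟ x)
... | true  = refl
... | false = findById-map-update i L ns x

findById-stepNeurons : ∀ {s ns e x M} → findById ns x ≡ just M →
  findById (stepNeurons s ns e) x ≡ just (update M (stepInput ns e) (length ns + s))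
findById-stepNeurons {s} {ns} {e} {x} found =
  trans (findById-map-update i L ns x) (cong (Maybe.map (λ N → update N i L)) found)
  where
  i = stepInput ns e
  L = length ns + s

findById-∈ : ∀ {ns N} → Unique (map id ns) → N ∈ ns → findById ns (id N) ≡ just N
findById-∈ {N ∷ _} _ (here refl) rewrite dec-true (id N ≟ id N) refl = refl
findById-∈ {M ∷ _} {N} (M∉ ∷ unique) (there N∈)
  rewrite dec-false (id M ≟ id N) (All.lookup M∉ (∈-map⁺ id N∈)) = findById-∈ unique N∈

headOf-found : ∀ {ns x M} → findById ns x ≡ just M → headOf ns x ≡ headB (output M)
headOf-found {ns} {x} found with findById ns x
headOf-found refl | just _ = refl

outputNC-found : ∀ NC N inp {M} → findById (processNeurons (si NC) (ln NC) inp) (id N) ≡ just M →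
  outputNC NC N inp ≡ just (output M)
outputNC-found NC N inp found with findById (processNeurons (si NC) (ln NC) inp) (id N)
outputNC-found NC N inp refl | just _ = refl

length-processNeurons : ∀ s ns bs → length (processNeurons s ns bs) ≡ length ns
length-processNeurons s ns []       = refl
length-processNeurons s ns (b ∷ bs) =
  trans (length-map _ (processNeurons s ns bs)) (length-processNeurons s ns bs)

stepInput-external : ∀ {ns e n} → length ns ≡ n → stepInput ns e n ≡ e n
stepInput-external {ns} refl rewrite <ᵇ-irrefl (length ns) = refl

stepInput-internal : ∀ {ns e x} → x < length ns → stepInput ns e x ≡ headOf ns x
stepInput-internal x<n rewrite Equivalence.to T-≡ (<⇒<ᵇ x<n) = refl

delayed : List Bool → List Bool
delayed []       = false ∷ []
delayed (_ ∷ bs) = bs ++ false ∷ false ∷ []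

delayed-∷ : ∀ b bs → delayed (b ∷ bs) ≡ headB (bs ++ false ∷ []) ∷ delayed bs
delayed-∷ _ []      = refl
delayed-∷ _ (_ ∷ _) = refl

delayed-just : ∀ inp → just (delayed inp) ≡
  (if 0 <ᵇ length inp then just (drop 1 inp ++ false ∷ false ∷ []) else just (false ∷ []))
delayed-just []      = refl
delayed-just (_ ∷ _) = refl

module OneSource (NC : NeuronalCircuit) (one-source : si NC ≡ 1) where

  n : ℕ
  n = length (ln NC)

  run : List Bool → List Neuron
  run = processNeurons (si NC) (ln NC)

  env-size : ∀ bs → length (run bs) + si NC ≡ suc n
  env-size bs rewrite length-processNeurons (si NC) (ln NC) bs | one-source = +-comm n 1

  record Relaying (x j : ℕ) (out : List Bool) (ms : List Neuron) : Set where
    field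
      neuron  : Neuron
      found   : findById ms x ≡ just neuron
      relay   : Relay j (suc n) neuron
      resting : Resting neuron
      emits   : output neuron ≡ out

  open Relaying

  initially : ∀ {N x j} → InitialNC NC → N ∈ ln NC → id N ≡ x → Relay j (suc n) N →
    Relaying x j (false ∷ []) (ln NC)
  initially {N} init N∈ refl r = record
    { neuron  = N
    ; found   = findById-∈ (ids-unique NC) N∈
    ; relay   = r
    ; resting = λ _ → proj₂ (All.lookup init N∈)
    ; emits   = proj₁ (All.lookup init N∈)
    }

  relaying-step : ∀ {x j out} b bs → Relaying x j out (run bs) →
    Relaying x j (stepInput (run bs) (λ _ → b) j ∷ out) (run (b ∷ bs))
  relaying-step {j = j} b bs R = record
    { neuron  = update (neuron R) i L
    ; found   = findById-stepNeurons {si NC} {run bs} {λ _ → b} (found R)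
    ; relay   = relay-update i L (relay R)
    ; resting = proj₂ step
    ; emits   = trans (proj₁ step) (cong (_ ∷_) (emits R))
    }
    where
    i = stepInput (run bs) (λ _ → b)
    L = length (run bs) + si NC
    step = relay-step (neuron R) i
                      (subst (λ L → Relay j L (neuron R)) (sym (env-size bs)) (relay R)) (resting R)

  input-neuron : Relaying 0 n (false ∷ []) (ln NC) →
    ∀ bs → Relaying 0 n (bs ++ false ∷ []) (run bs)
  input-neuron R₀ []       = R₀
  input-neuron R₀ (b ∷ bs) =
    subst (λ c → Relaying 0 n (c ∷ bs ++ false ∷ []) (run (b ∷ bs)))
          (stepInput-external {run bs} {λ _ → b} (length-processNeurons (si NC) (ln NC) bs))
          (relaying-step b bs (input-neuron R₀ bs))

  relay-neuron : ∀ {x} → 0 < n →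
    Relaying 0 n (false ∷ []) (ln NC) → Relaying x 0 (false ∷ []) (ln NC) →
    ∀ bs → Relaying x 0 (delayed bs) (run bs)
  relay-neuron 0<n R₀ R []       = R
  relay-neuron {x} 0<n R₀ R (b ∷ bs) =
    subst (λ out → Relaying x 0 out (run (b ∷ bs))) (sym reads-input-neuron)
          (relaying-step b bs (relay-neuron 0<n R₀ R bs))
    where
    open ≡-Reasoning
    reads-input-neuron : delayed (b ∷ bs) ≡ stepInput (run bs) (λ _ → b) 0 ∷ delayed bs
    reads-input-neuron = begin
      delayed (b ∷ bs)
        ≡⟨ delayed-∷ b bs ⟩
      headB (bs ++ false ∷ []) ∷ delayed bs
        ≡⟨ cong (_∷ delayed bs) (cong headB (emits R₀′)) ⟨
      headB (output (neuron R₀′)) ∷ delayed bs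
        ≡⟨ cong (_∷ delayed bs) (headOf-found {run bs} (found R₀′)) ⟨
      headOf (run bs) 0 ∷ delayed bs
        ≡⟨ cong (_∷ delayed bs) (stepInput-internal {run bs} {λ _ → b} 0<len) ⟨
      stepInput (run bs) (λ _ → b) 0 ∷ delayed bs
        ∎
      where
      R₀′ = input-neuron R₀ bs
      0<len = subst (0 <_) (sym (length-processNeurons (si NC) (ln NC) bs)) 0<n

  observe : ∀ {N x j out} inp → id N ≡ x → Relaying x j out (run inp) →
    outputNC NC N inp ≡ just out
  observe {N} inp refl R = trans (outputNC-found NC N inp (found R)) (cong just (emits R))

proposition6p2 : (NC : NeuronalCircuit) → InitialNC NC → ParallelComposition NC →
    (N₀ : Neuron) → N₀ ∈ ln NC → id N₀ ≡ 0 → τ N₀ ≤ w N₀ (length (ln NC)) →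
    (inp : List Bool) →
    (outputNC NC N₀ inp ≡ just (inp ++ false ∷ [])) ×
    (∀ N → N ∈ ln NC → id N ≢ 0 → τ N ≤ w N 0 →
      outputNC NC N inp ≡
        (if 0 <ᵇ length inp then just (drop 1 inp ++ false ∷ false ∷ []) else just (false ∷ [])))
proposition6p2 NC init (one-source , 0<n , input-wiring , relay-wiring) N₀ N₀∈ id≡0 τ≤w inp =
    observe {N₀} inp id≡0 (input-neuron R₀ inp)
  , λ N N∈ id≢0 τ≤w′ →
      let R = initially {N} init N∈ refl (relay-of N N∈ id≢0 τ≤w′)
      in trans (observe {N} inp refl (relay-neuron 0<n R₀ R inp)) (delayed-just inp)
  where
  open OneSource NC one-source

  R₀ : Relaying 0 n (false ∷ []) (ln NC)
  R₀ = initially init N₀∈ id≡0 record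
    { source<env    = n<1+n n
    ; others-silent = λ k k≢n k<1+n →
        proj₁ (input-wiring N₀ N₀∈ id≡0) k (≤∧≢⇒< (m<1+n⇒m≤n k<1+n) k≢n)
    ; strong        = τ≤w
    }

  relay-of : ∀ N → N ∈ ln NC → id N ≢ 0 → τ N ≤ w N 0 → Relay 0 (suc n) N
  relay-of N N∈ id≢0 τ≤w′ = record
    { source<env    = z<s
    ; others-silent =
        proj₁ (relay-wiring (pred (id N)) N N∈ (sym (suc-pred (id N) {{≢-nonZero id≢0}})))
    ; strong        = τ≤w′
    }
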